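{- Let $H$ be an $n\times n$ complex matrix whose entries are complex $q$th roots of unity with $HH^\ast=nI_n$, and suppose $H$ is in canonical form. Let $r_2$ be the second row of $L(H)$ and $c_2$ the second column of $L(H)$. Then $r_2\in\mathcal{O}(n,q)$ and $c_2^T\in\mathcal{O}(n,q)$.
   Context: $\mathbb{Z}_q$ denotes the integers modulo $q$ with underlying set $\{0,\dots,q-1\}$; for any $m$, $\mathbb{Z}_q^m$ is linearly ordered by $\prec$, where $a\prec b$ iff $a=b$ or $a$ lexicographically precedes $b$. For a matrix $R$ with entries $q$th roots of unity, its logarithmic form is $L(R)=[\varphi_{j,k}]$ with $\varphi_{j,k}\in\mathbb{Z}_q$ and $R_{j,k}=\exp(2\pi\mathbf{i}\varphi_{j,k}/q)$. The vectorization $v(R)$ is the concatenation of the rows of $L(R)$. A $q$th root monomial matrix is a square matrix with exactly one nonzero entry in each row and column, that entry a complex $q$th root of unity. An $r\times n$ matrix $R$ is in canonical form if $v(R)=\min\{v(XRY^\ast)\colon X,Y\ q\text{th root monomial matrices of sizes } r, n\}$ (minimum w.r.t. $\prec$). For $x\in\mathbb{Z}_q^n$, $\mathrm{Sort}(x)$ is the $\prec$-minimum over all coordinate permutations of $x$, and $\mathcal{E}_{n,q}(x)=\sum_{i=1}^n\exp(2\pi\mathbf{i}x_i/q)$. Define $\mathcal{O}(n,q):=\{x\in\mathbb{Z}_q^n\colon x_1=0,\ x=\mathrm{Sort}(x),\ \mathcal{E}_{n,q}(x)=0\}$. -}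

module Defs where

open import Level using (Level; _⊔_)
open import Data.Nat using (ℕ; zero; suc; _+_; _∸_; _<_; NonZero)
open import Data.Nat.DivMod using (_mod_)
open import Data.Fin using (Fin; toℕ; _≟_)
import Data.Fin as Fin
open import Data.Bool using (if_then_else_)
open import Relation.Nullary.Decidable using (⌊_⌋)
open import Data.List using (List; []; _∷_; map; concatMap; allFin)
open import Data.Product using (Σ; _×_; ∃-syntax; Σ-syntax)
open import Data.Sum using (_⊎_)
open import Data.Empty using (⊥)
open import Data.Unit using (⊤)
open import Relation.Nullary using (¬_; yes; no)
open import Relation.Binary.PropositionalEquality using (_≡_)
open import Data.Fin.Permutation using (Permutation′; _⟨$⟩ʳ_)
open import Algebra.Bundles using (CommutativeRing)

-- Z_q is Fin q; the order ≼ on Z_q^m (here: lists) is "equal or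
-- lexicographically smaller" (comparison of entries by their values in {0..q-1}).

_≼_ : ∀ {q} → List (Fin q) → List (Fin q) → Set
[] ≼ [] = ⊤
[] ≼ (_ ∷ _) = ⊥
(_ ∷ _) ≼ [] = ⊥
(x ∷ xs) ≼ (y ∷ ys) = (toℕ x < toℕ y) ⊎ ((x ≡ y) × (xs ≼ ys))

IsMinimum : ∀ {q} → (List (Fin q) → Set) → List (Fin q) → Set
IsMinimum S x = S x × (∀ y → S y → x ≼ y)

-- Matrices with q-th root of unity entries are represented by their
-- logarithmic form L(R) : Fin r → Fin n → Z_q  (R_{j,k} = ω^{L(R)_{j,k}}).

LogMatrix : ℕ → ℕ → ℕ → Set
LogMatrix r n q = Fin r → Fin n → Fin q

vecM : ∀ {r n q} → LogMatrix r n q → List (Fin q)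
vecM {r} {n} L = concatMap (λ j → map (λ k → L j k) (allFin n)) (allFin r)

vecV : ∀ {n q} → (Fin n → Fin q) → List (Fin q)
vecV {n} x = map x (allFin n)

-- Action of q-th root monomial matrices X = (diag(ω^a)) P_σ, Y = (diag(ω^b)) P_τ:
-- L(X R Y*)_{j,k} = a_j + L(R)_{σ j, τ k} - b_k  (mod q)
monomialAction : ∀ {r n q} .{{_ : NonZero q}} →
  Permutation′ r → Permutation′ n → (Fin r → Fin q) → (Fin n → Fin q) →
  LogMatrix r n q → LogMatrix r n q
monomialAction {q = q} σ τ a b L j k =
  (toℕ (a j) + toℕ (L (σ ⟨$⟩ʳ j) (τ ⟨$⟩ʳ k)) + (q ∸ toℕ (b k))) mod q

OrbitVecs : ∀ {r n q} .{{_ : NonZero q}} → LogMatrix r n q → List (Fin q) → Set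
OrbitVecs {r} {n} {q} L v =
  ∃[ σ ] ∃[ τ ] ∃[ a ] ∃[ b ] (v ≡ vecM (monomialAction {r} {n} {q} σ τ a b L))

IsCanonical : ∀ {r n q} .{{_ : NonZero q}} → LogMatrix r n q → Set
IsCanonical L = IsMinimum (OrbitVecs L) (vecM L)

-- Sort(x) = x : x is the minimum of { x ∘ π : π permutation of coordinates }
IsSorted : ∀ {n q} → (Fin n → Fin q) → Set
IsSorted {n} x = IsMinimum (λ v → Σ[ π ∈ Permutation′ n ] (v ≡ vecV (λ i → x (π ⟨$⟩ʳ i)))) (vecV x)

-- Complex arithmetic on q-th roots of unity is carried out in an arbitrary
-- integral domain K of characteristic 0 containing a primitive q-th root of
-- unity ω (ℂ with ω = exp(2πi/q) is such a setting).

module _ {c ℓ : Level} (K : CommutativeRing c ℓ) where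
  open CommutativeRing K using (Carrier; _≈_; 0#; 1#)
    renaming (_+_ to _+K_; _*_ to _*K_)

  pow : Carrier → ℕ → Carrier
  pow x zero = 1#
  pow x (suc k) = x *K pow x k

  natK : ℕ → Carrier
  natK zero = 0#
  natK (suc k) = 1# +K natK k

  sumF : (n : ℕ) → (Fin n → Carrier) → Carrier
  sumF zero f = 0#
  sumF (suc n) f = f Fin.zero +K sumF n (λ i → f (Fin.suc i))

  record CharZeroDomain : Set (c ⊔ ℓ) where
    field
      nontrivial  : ¬ (1# ≈ 0#)
      noZeroDiv   : ∀ x y → x *K y ≈ 0# → (x ≈ 0#) ⊎ (y ≈ 0#)
      charZero    : ∀ k → ¬ (natK (suc k) ≈ 0#)

  record PrimitiveRoot (q : ℕ) (ω : Carrier) : Set ℓ where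
    field
      root      : pow ω q ≈ 1#
      isPrimitive : ∀ k → 0 < k → k < q → ¬ (pow ω k ≈ 1#)

  entry : (q : ℕ) → Carrier → Fin q → Carrier
  entry q ω φ = pow ω (toℕ φ)

  conjEntry : (q : ℕ) → Carrier → Fin q → Carrier
  conjEntry q ω φ = pow ω (q ∸ toℕ φ)

  IsButsonHadamard : (n q : ℕ) → Carrier → LogMatrix n n q → Set ℓ
  IsButsonHadamard n q ω L = ∀ j k →
    sumF n (λ i → entry q ω (L j i) *K conjEntry q ω (L k i)) ≈
      (if ⌊ j ≟ k ⌋ then natK n else 0#)

  E : (n q : ℕ) → Carrier → (Fin n → Fin q) → Carrier
  E n q ω x = sumF n (λ i → entry q ω (x i))

  -- O(n,q) for n ≥ 1 (n = suc m)
  InO : (m q : ℕ) → Carrier → (Fin (suc m) → Fin q) → Set ℓ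
  InO m q ω x = (toℕ (x Fin.zero) ≡ 0) × IsSorted x × (E (suc m) q ω x ≈ 0#)

-- Canonicity pins down the first row and column of L = L(H): multiplying the columns by the
-- conjugates of the first row (resp. the rows by those of the first column) turns them into 0
-- without disturbing what comes before, so by minimality of v(L) they already vanish. Permuting
-- columns cannot decrease v(L), so the second row is sorted; swapping rows j < k shows that row j
-- is lexicographically below row k, and as both start with 0 the second column is nondecreasing.
--
-- With the first row of H all ones, Σₖ H₁ₖ = ⟨row 1, row 0⟩ = 0 by H H* = n I. The same argument
-- for the second column needs H* H = n I. Over a domain of characteristic 0 this follows from
-- H H* = n I by determinants: det H · det H* = nⁿ ≠ 0, so every row vector T with T H* = 0 is 0,
-- and T = (H* H − n I)ᵢ is such a vector. Multiplicativity of the Leibniz determinant comes from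
-- the fact that g ↦ det (rows g of A) is alternating, hence equal to ε g · det A after sorting g
-- by adjacent transpositions.

module Submission where

open import Level using (_⊔_)
open import Function using (_∘_; id)
open import Data.Nat as ℕ using (ℕ; zero; suc; NonZero; z≤n; s≤s; _∸_)
import Data.Nat.Properties as ℕ
open import Data.Fin as Fin using (Fin; zero; suc; toℕ; _≤_; _<_)
open import Data.Fin.Properties using (toℕ-injective; toℕ<n)
open import Data.Fin.Permutation as Perm using (Permutation′; _⟨$⟩ʳ_; transpose)
import Data.Fin.Permutation.Components as PC
open import Data.List using (tabulate)
open import Data.Product using (∃; _×_; _,_; proj₁; proj₂)
open import Data.Sum using (_⊎_; inj₁; inj₂)
open import Data.Empty using (⊥-elim)
open import Relation.Nullary using (¬_; yes; no; contradiction)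
open import Relation.Binary.Core using (_Preserves_⟶_)
open import Relation.Binary.PropositionalEquality as ≡ using (_≡_; _≢_; _≗_)
open import Algebra.Bundles using (CommutativeRing)
open import Defs

module Sequences where

  open import Data.Fin using (fromℕ; inject₁)
  open import Data.Fin.Properties using (toℕ-fromℕ)
  open import Data.Fin.Permutation using (permutation)
  open import Data.Vec.Functional using (_∷_; head; tail)
  open import Data.Vec.Functional.Properties using (∷-cong)
  open import Data.List.Relation.Unary.Linked using (Linked; [-]) renaming (_∷_ to _∷ₗ_)
  open ≡ using (refl; sym; trans; cong; subst)

  ∷-congʳ : ∀ {k} {A : Set} (a : A) {f g : Fin k → A} → f ≗ g → a ∷ f ≗ a ∷ g
  ∷-congʳ a f≗g = ∷-cong refl f≗g

  ∷-η : ∀ {k} {A : Set} (f : Fin (suc k) → A) → head f ∷ tail f ≗ f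
  ∷-η f = ∷-cong refl (λ _ → refl)

  swapAdjacent : ∀ {k} → Fin k → Fin (suc k) → Fin (suc k)
  swapAdjacent zero    zero          = suc zero
  swapAdjacent zero    (suc zero)    = zero
  swapAdjacent zero    (suc (suc j)) = suc (suc j)
  swapAdjacent (suc i) zero          = zero
  swapAdjacent (suc i) (suc j)       = suc (swapAdjacent i j)

  swapAdjacent-involutive : ∀ {k} (i : Fin k) j → swapAdjacent i (swapAdjacent i j) ≡ j
  swapAdjacent-involutive zero    zero          = refl
  swapAdjacent-involutive zero    (suc zero)    = refl
  swapAdjacent-involutive zero    (suc (suc j)) = refl
  swapAdjacent-involutive (suc i) zero          = refl
  swapAdjacent-involutive (suc i) (suc j)       = cong suc (swapAdjacent-involutive i j)

  swapAdjacentₚ : ∀ {k} → Fin k → Permutation′ (suc k)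
  swapAdjacentₚ i = permutation (swapAdjacent i) (swapAdjacent i)
    (swapAdjacent-involutive i) (swapAdjacent-involutive i)

  argmin : ∀ {k n} (g : Fin (suc k) → Fin n) → ∃ λ j → ∀ i → g j ≤ g i
  argmin {zero}  g = zero , λ { zero → ℕ.≤-refl }
  argmin {suc k} g with argmin (tail g)
  ... | j , min with g zero Fin.≤? g (suc j)
  ... | yes g₀≤ = zero , λ { zero → ℕ.≤-refl ; (suc i) → ℕ.≤-trans g₀≤ (min i) }
  ... | no  g₀≰ = suc j , λ { zero → ℕ.<⇒≤ (ℕ.≰⇒> g₀≰) ; (suc i) → min i }

  nondecreasing-split : ∀ {k n} (h : Fin (suc k) → Fin n) → Linked _≤_ (tabulate h) →
    (∃ λ i → h (inject₁ i) ≡ h (suc i)) ⊎ Linked _<_ (tabulate h)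
  nondecreasing-split {zero}  h [-] = inj₂ [-]
  nondecreasing-split {suc k} h (h₀≤h₁ ∷ₗ h′-nondecreasing) with h zero Fin.≟ h (suc zero)
  ... | yes h₀≡h₁ = inj₁ (zero , h₀≡h₁)
  ... | no  h₀≢h₁ with nondecreasing-split (tail h) h′-nondecreasing
  ...   | inj₁ (i , eq)         = inj₁ (suc i , eq)
  ...   | inj₂ h′-increasing = inj₂ (ℕ.≤∧≢⇒< h₀≤h₁ (h₀≢h₁ ∘ toℕ-injective) ∷ₗ h′-increasing)

  increasing-lowerBound : ∀ {k n} (h : Fin (suc k) → Fin n) → Linked _<_ (tabulate h) →
    ∀ i → toℕ (h zero) ℕ.+ toℕ i ℕ.≤ toℕ (h i)
  increasing-lowerBound h _ zero = ℕ.≤-reflexive (ℕ.+-identityʳ _)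
  increasing-lowerBound {suc k} h (h₀<h₁ ∷ₗ h′-increasing) (suc i) = begin
    toℕ (h zero) ℕ.+ suc (toℕ i)  ≡⟨ ℕ.+-suc _ _ ⟩
    suc (toℕ (h zero)) ℕ.+ toℕ i  ≤⟨ ℕ.+-monoˡ-≤ (toℕ i) h₀<h₁ ⟩
    toℕ (h (suc zero)) ℕ.+ toℕ i  ≤⟨ increasing-lowerBound (tail h) h′-increasing i ⟩
    toℕ (h (suc i))               ∎
    where open ℕ.≤-Reasoning

  increasing-upperBound : ∀ {k n} (h : Fin (suc k) → Fin n) → Linked _<_ (tabulate h) →
    ∀ i → toℕ (h i) ℕ.+ (k ∸ toℕ i) ℕ.≤ toℕ (h (fromℕ k))
  increasing-upperBound {k} h h-increasing zero =
    subst (λ t → toℕ (h zero) ℕ.+ t ℕ.≤ toℕ (h (fromℕ k))) (toℕ-fromℕ k)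
      (increasing-lowerBound h h-increasing (fromℕ k))
  increasing-upperBound {suc k} h (_ ∷ₗ h′-increasing) (suc i) = increasing-upperBound (tail h) h′-increasing i

  increasing⇒≗id : ∀ {m} (h : Fin (suc m) → Fin (suc m)) → Linked _<_ (tabulate h) → h ≗ id
  increasing⇒≗id {m} h h-increasing i = toℕ-injective (ℕ.≤-antisym upper lower)
    where
    i≤m : toℕ i ℕ.≤ m
    i≤m = ℕ.≤-pred (toℕ<n i)
    lower : toℕ i ℕ.≤ toℕ (h i)
    lower = ℕ.≤-trans (ℕ.m≤n+m _ _) (increasing-lowerBound h h-increasing i)
    upper : toℕ (h i) ℕ.≤ toℕ i
    upper = ℕ.+-cancelʳ-≤ (m ∸ toℕ i) _ _ (begin
      toℕ (h i) ℕ.+ (m ∸ toℕ i)  ≤⟨ increasing-upperBound h h-increasing i ⟩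
      toℕ (h (fromℕ m))          ≤⟨ ℕ.≤-pred (toℕ<n (h (fromℕ m))) ⟩
      m                          ≡⟨ ℕ.m+[n∸m]≡n i≤m ⟨
      toℕ i ℕ.+ (m ∸ toℕ i)      ∎)
      where open ℕ.≤-Reasoning

  swapAdjacent-fixes : ∀ {k} {A : Set} (h : Fin (suc k) → A) (i : Fin k) →
    h (inject₁ i) ≡ h (suc i) → h ∘ swapAdjacent i ≗ h
  swapAdjacent-fixes h zero    eq zero          = sym eq
  swapAdjacent-fixes h zero    eq (suc zero)    = eq
  swapAdjacent-fixes h zero    eq (suc (suc j)) = refl
  swapAdjacent-fixes h (suc i) eq zero          = refl
  swapAdjacent-fixes h (suc i) eq (suc j)       = swapAdjacent-fixes (tail h) i eq j

  transpose-matchˡ : ∀ {n} (i j : Fin n) → PC.transpose i j i ≡ j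
  transpose-matchˡ i j with i Fin.≟ i
  ... | yes _   = refl
  ... | no  i≢i = ⊥-elim (i≢i refl)

  transpose-other : ∀ {n} (i j k : Fin n) → k ≢ i → k ≢ j → PC.transpose i j k ≡ k
  transpose-other i j k k≢i k≢j with k Fin.≟ i
  ... | yes k≡i = ⊥-elim (k≢i k≡i)
  ... | no  _ with k Fin.≟ j
  ...   | yes k≡j = ⊥-elim (k≢j k≡j)
  ...   | no  _   = refl

  transpose-invariant : ∀ {n} {A : Set} (x : Fin n → A) (i j : Fin n) → x i ≡ x j → x ∘ PC.transpose i j ≗ x
  transpose-invariant x i j xi≡xj k with k Fin.≟ i
  ... | yes k≡i = trans (sym xi≡xj) (cong x (sym k≡i))
  ... | no  _ with k Fin.≟ j
  ...   | yes k≡j = trans xi≡xj (cong x (sym k≡j))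
  ...   | no  _   = refl

module Determinant {c ℓ} (R : CommutativeRing c ℓ) where

  open import Data.Fin using (inject₁; punchIn)
  open import Data.Vec.Functional using (_∷_; head; tail)
  open import Data.List.Relation.Unary.Linked using (Linked; [-]) renaming (_∷_ to _∷ₗ_)
  open import Data.Bool using (if_then_else_)
  open import Relation.Nullary.Decidable using (⌊_⌋)
  open Sequences
  open CommutativeRing R hiding (zero)
  open import Algebra.Properties.Ring ring using (-‿involutive; -0#≈0#; -‿distribˡ-*; -‿distribʳ-*; -1*x≈-x)
  open import Algebra.Properties.CommutativeSemigroup *-commutativeSemigroup using (x∙yz≈y∙xz; interchange)
  open import Algebra.Properties.Semiring.Sum semiring
    using (sum; sum-cong-≋; sum-permute; sum-replicate-zero; ∑-comm; ∑-distrib-+; *-distribˡ-sum; *-distribʳ-sum)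
  open import Algebra.Properties.CommutativeMonoid.Sum *-commutativeMonoid
    using () renaming (sum to product; sum-cong-≋ to product-cong; sum-permute to product-permute; ∑-distrib-+ to product-distrib-*)
  open import Algebra.Properties.Group +-group using (x∙y⁻¹≈ε⇒x≈y)
  open import Relation.Binary.Reasoning.Setoid setoid

  sum-zero : ∀ {n} {f : Fin n → Carrier} → (∀ i → f i ≈ 0#) → sum f ≈ 0#
  sum-zero {n} f≈0 = trans (sum-cong-≋ f≈0) (sum-replicate-zero n)

  product-zero : ∀ {n} (f : Fin n → Carrier) (i : Fin n) → f i ≈ 0# → product f ≈ 0#
  product-zero f zero    fi≈0 = trans (*-congʳ fi≈0) (zeroˡ _)
  product-zero f (suc i) fi≈0 = trans (*-congˡ (product-zero (tail f) i fi≈0)) (zeroʳ _)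

  product-one : ∀ {n} {f : Fin n → Carrier} → (∀ i → f i ≈ 1#) → product f ≈ 1#
  product-one {zero}  f≈1 = refl
  product-one {suc n} f≈1 = trans (*-cong (f≈1 zero) (product-one (f≈1 ∘ suc))) (*-identityˡ 1#)

  product-const : ∀ n x → product {n} (λ _ → x) ≈ pow R x n
  product-const zero    x = refl
  product-const (suc n) x = *-congˡ (product-const n x)

  δ : ∀ {n} → Fin n → Fin n → Carrier
  δ zero    zero    = 1#
  δ zero    (suc j) = 0#
  δ (suc i) zero    = 0#
  δ (suc i) (suc j) = δ i j

  δ-sym : ∀ {n} (i j : Fin n) → δ i j ≡ δ j i
  δ-sym zero    zero    = ≡.refl
  δ-sym zero    (suc j) = ≡.refl
  δ-sym (suc i) zero    = ≡.refl
  δ-sym (suc i) (suc j) = δ-sym i j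

  if-≟≈*δ : ∀ {n} (i j : Fin n) x → (if ⌊ i Fin.≟ j ⌋ then x else 0#) ≈ x * δ i j
  if-≟≈*δ zero    zero    x = sym (*-identityʳ x)
  if-≟≈*δ zero    (suc j) x = sym (zeroʳ x)
  if-≟≈*δ (suc i) zero    x = sym (zeroʳ x)
  if-≟≈*δ (suc i) (suc j) x with i Fin.≟ j | if-≟≈*δ i j x
  ... | yes _ | eq = eq
  ... | no _  | eq = eq

  ∑-δ : ∀ {n} (i : Fin n) (f : Fin n → Carrier) → sum (λ j → δ i j * f j) ≈ f i
  ∑-δ zero f = begin
    1# * f zero + sum (λ j → 0# * f (suc j))  ≈⟨ +-cong (*-identityˡ _) (sum-zero (λ j → zeroˡ (f (suc j)))) ⟩
    f zero + 0#                                ≈⟨ +-identityʳ _ ⟩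
    f zero                                     ∎
  ∑-δ (suc i) f = trans (+-cong (zeroˡ _) (∑-δ i (tail f))) (+-identityˡ _)

  ∑ᶠ : ∀ {n} k → ((Fin k → Fin n) → Carrier) → Carrier
  ∑ᶠ zero    h = h (λ ())
  ∑ᶠ (suc k) h = sum (λ a → ∑ᶠ k (λ f → h (a ∷ f)))

  ∑ᶠ-cong : ∀ {n} k {h h′ : (Fin k → Fin n) → Carrier} → (∀ f → h f ≈ h′ f) → ∑ᶠ k h ≈ ∑ᶠ k h′
  ∑ᶠ-cong zero    h≈h′ = h≈h′ _
  ∑ᶠ-cong (suc k) h≈h′ = sum-cong-≋ (λ a → ∑ᶠ-cong k (λ f → h≈h′ (a ∷ f)))

  ∑ᶠ-zero : ∀ {n} k {h : (Fin k → Fin n) → Carrier} → (∀ f → h f ≈ 0#) → ∑ᶠ k h ≈ 0#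
  ∑ᶠ-zero zero    h≈0 = h≈0 _
  ∑ᶠ-zero (suc k) h≈0 = sum-zero (λ a → ∑ᶠ-zero k (λ f → h≈0 (a ∷ f)))

  *-distribˡ-∑ᶠ : ∀ {n} k x (h : (Fin k → Fin n) → Carrier) → x * ∑ᶠ k h ≈ ∑ᶠ k (λ f → x * h f)
  *-distribˡ-∑ᶠ zero    x h = refl
  *-distribˡ-∑ᶠ (suc k) x h = trans (*-distribˡ-sum x (λ a → ∑ᶠ k (λ f → h (a ∷ f))))
                                    (sum-cong-≋ (λ a → *-distribˡ-∑ᶠ k x (λ f → h (a ∷ f))))

  *-distribʳ-∑ᶠ : ∀ {n} k x (h : (Fin k → Fin n) → Carrier) → ∑ᶠ k h * x ≈ ∑ᶠ k (λ f → h f * x)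
  *-distribʳ-∑ᶠ k x h = trans (*-comm _ x) (trans (*-distribˡ-∑ᶠ k x h) (∑ᶠ-cong k (λ f → *-comm x _)))

  -‿∑ᶠ : ∀ {n} k (h : (Fin k → Fin n) → Carrier) → ∑ᶠ k (λ f → - h f) ≈ - ∑ᶠ k h
  -‿∑ᶠ k h = trans (∑ᶠ-cong k (λ f → sym (-1*x≈-x _))) (trans (sym (*-distribˡ-∑ᶠ k _ h)) (-1*x≈-x _))

  ∑ᶠ-comm-sum : ∀ {n} k m (h : (Fin k → Fin n) → Fin m → Carrier) →
    ∑ᶠ k (λ f → sum (h f)) ≈ sum (λ j → ∑ᶠ k (λ f → h f j))
  ∑ᶠ-comm-sum zero    m h = refl
  ∑ᶠ-comm-sum (suc k) m h = trans (sum-cong-≋ (λ a → ∑ᶠ-comm-sum k m (λ f → h (a ∷ f))))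
                                  (∑-comm (λ a j → ∑ᶠ k (λ f → h (a ∷ f) j)))

  ∑ᶠ-comm : ∀ {n} k l (h : (Fin k → Fin n) → (Fin l → Fin n) → Carrier) →
    ∑ᶠ k (λ f → ∑ᶠ l (h f)) ≈ ∑ᶠ l (λ g → ∑ᶠ k (λ f → h f g))
  ∑ᶠ-comm zero    l h = refl
  ∑ᶠ-comm (suc k) l h = trans (sum-cong-≋ (λ a → ∑ᶠ-comm k l (λ f → h (a ∷ f))))
                              (sym (∑ᶠ-comm-sum l _ (λ g a → ∑ᶠ k (λ f → h (a ∷ f) g))))

  product-sum : ∀ {n} k (x : Fin k → Fin n → Carrier) →
    product (λ i → sum (x i)) ≈ ∑ᶠ k (λ g → product (λ i → x i (g i)))
  product-sum zero    x = refl
  product-sum (suc k) x = begin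
    sum (x zero) * product (λ i → sum (x (suc i)))
      ≈⟨ *-congˡ (product-sum k (tail x)) ⟩
    sum (x zero) * ∑ᶠ k (λ g → product (λ i → x (suc i) (g i)))
      ≈⟨ *-distribʳ-sum (∑ᶠ k (λ g → product (λ i → x (suc i) (g i)))) (x zero) ⟩
    sum (λ a → x zero a * ∑ᶠ k (λ g → product (λ i → x (suc i) (g i))))
      ≈⟨ sum-cong-≋ (λ a → *-distribˡ-∑ᶠ k (x zero a) (λ g → product (λ i → x (suc i) (g i)))) ⟩
    ∑ᶠ (suc k) (λ g → product (λ i → x i (g i))) ∎

  ∑ᶠ-δ : ∀ {n} k (e : Fin k → Fin n) (h : (Fin k → Fin n) → Carrier) → h Preserves _≗_ ⟶ _≈_ →
    ∑ᶠ k (λ f → h f * product (λ i → δ (e i) (f i))) ≈ h e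
  ∑ᶠ-δ zero    e h h-cong = trans (*-identityʳ _) (h-cong (λ ()))
  ∑ᶠ-δ (suc k) e h h-cong = begin
    sum (λ a → ∑ᶠ k (λ f → h (a ∷ f) * (δ (head e) a * Δ f)))
      ≈⟨ sum-cong-≋ (λ a → trans (∑ᶠ-cong k (λ f → x∙yz≈y∙xz (h (a ∷ f)) (δ (head e) a) (Δ f)))
                                 (sym (*-distribˡ-∑ᶠ k _ (λ f → h (a ∷ f) * Δ f)))) ⟩
    sum (λ a → δ (head e) a * ∑ᶠ k (λ f → h (a ∷ f) * Δ f))
      ≈⟨ ∑-δ (head e) (λ a → ∑ᶠ k (λ f → h (a ∷ f) * Δ f)) ⟩
    ∑ᶠ k (λ f → h (head e ∷ f) * Δ f)
      ≈⟨ ∑ᶠ-δ k (tail e) (λ f → h (head e ∷ f)) (λ f≗g → h-cong (∷-congʳ (head e) f≗g)) ⟩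
    h (head e ∷ tail e)
      ≈⟨ h-cong (∷-η e) ⟩
    h e ∎
    where
    Δ : (Fin k → Fin _) → Carrier
    Δ f = product (λ i → δ (e (suc i)) (f i))

  ∑ᶠ-swapAdjacent : ∀ {n} k (i : Fin k) (h : (Fin (suc k) → Fin n) → Carrier) → h Preserves _≗_ ⟶ _≈_ →
    ∑ᶠ (suc k) (λ f → h (f ∘ swapAdjacent i)) ≈ ∑ᶠ (suc k) h
  ∑ᶠ-swapAdjacent (suc k) zero h h-cong = begin
    sum (λ a → sum (λ b → ∑ᶠ k (λ f → h ((a ∷ b ∷ f) ∘ swapAdjacent zero))))
      ≈⟨ sum-cong-≋ (λ a → sum-cong-≋ (λ b → ∑ᶠ-cong k (λ f → h-cong (swap-cons a b f)))) ⟩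
    sum (λ a → sum (λ b → ∑ᶠ k (λ f → h (b ∷ a ∷ f))))
      ≈⟨ ∑-comm (λ a b → ∑ᶠ k (λ f → h (b ∷ a ∷ f))) ⟩
    sum (λ b → sum (λ a → ∑ᶠ k (λ f → h (b ∷ a ∷ f)))) ∎
    where
    swap-cons : ∀ {A : Set} (a b : A) f → (a ∷ b ∷ f) ∘ swapAdjacent zero ≗ b ∷ a ∷ f
    swap-cons a b f zero          = ≡.refl
    swap-cons a b f (suc zero)    = ≡.refl
    swap-cons a b f (suc (suc j)) = ≡.refl
  ∑ᶠ-swapAdjacent (suc k) (suc i) h h-cong = sum-cong-≋ (λ a →
    trans (∑ᶠ-cong (suc k) {λ f → h ((a ∷ f) ∘ swapAdjacent (suc i))} {λ f → h (a ∷ f ∘ swapAdjacent i)}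
                   (λ f → h-cong (≡.sym ∘ ∷-η ((a ∷ f) ∘ swapAdjacent (suc i)))))
          (∑ᶠ-swapAdjacent k i (λ f → h (a ∷ f)) (λ f≗g → h-cong (∷-congʳ a f≗g))))

  sgn : ∀ {n} → Fin n → Fin n → Carrier
  sgn zero    zero    = 0#
  sgn zero    (suc b) = 1#
  sgn (suc a) zero    = - 1#
  sgn (suc a) (suc b) = sgn a b

  sgn-antisym : ∀ {n} (a b : Fin n) → sgn b a ≈ - sgn a b
  sgn-antisym zero    zero    = sym -0#≈0#
  sgn-antisym zero    (suc b) = refl
  sgn-antisym (suc a) zero    = sym (-‿involutive 1#)
  sgn-antisym (suc a) (suc b) = sgn-antisym a b

  sgn-refl : ∀ {n} (a : Fin n) → sgn a a ≈ 0#
  sgn-refl zero    = refl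
  sgn-refl (suc a) = sgn-refl a

  sgn-< : ∀ {n} {a b : Fin n} → a < b → sgn a b ≈ 1#
  sgn-< {a = zero}  {suc b} _         = refl
  sgn-< {a = suc a} {suc b} (s≤s a<b) = sgn-< a<b

  ε : ∀ {k n} → (Fin k → Fin n) → Carrier
  ε {zero}  f = 1#
  ε {suc k} f = product (λ j → sgn (head f) (f (suc j))) * ε (tail f)

  ε-cong : ∀ {k n} → ε {k} {n} Preserves _≗_ ⟶ _≈_
  ε-cong {zero}  f≗g = refl
  ε-cong {suc k} f≗g =
    *-cong (product-cong (λ j → reflexive (≡.cong₂ sgn (f≗g zero) (f≗g (suc j))))) (ε-cong (f≗g ∘ suc))

  ε-swapAdjacent : ∀ {k n} (i : Fin k) (f : Fin (suc k) → Fin n) → ε (f ∘ swapAdjacent i) ≈ - ε f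
  ε-swapAdjacent {suc k} zero f = begin
    (sgn (f (suc zero)) (f zero) * p₁) * (p₀ * ε f″)  ≈⟨ *-congʳ (*-congʳ (sgn-antisym (f zero) (f (suc zero)))) ⟩
    (- sgn (f zero) (f (suc zero)) * p₁) * (p₀ * ε f″) ≈⟨ *-congʳ (sym (-‿distribˡ-* _ p₁)) ⟩
    - (sgn (f zero) (f (suc zero)) * p₁) * (p₀ * ε f″) ≈⟨ sym (-‿distribˡ-* _ _) ⟩
    - ((sgn (f zero) (f (suc zero)) * p₁) * (p₀ * ε f″)) ≈⟨ -‿cong (interchange _ p₁ p₀ (ε f″)) ⟩
    - ((sgn (f zero) (f (suc zero)) * p₀) * (p₁ * ε f″)) ∎
    where
    f″ = tail (tail f)
    p₀ = product (λ j → sgn (f zero) (f″ j))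
    p₁ = product (λ j → sgn (f (suc zero)) (f″ j))
  ε-swapAdjacent {suc k} (suc i) f = begin
    product (λ j → sgn (head f) (tail f (swapAdjacent i j))) * ε (tail f ∘ swapAdjacent i)
      ≈⟨ *-cong (sym (product-permute (λ j → sgn (head f) (tail f j)) (swapAdjacentₚ i)))
                (ε-swapAdjacent i (tail f)) ⟩
    product (λ j → sgn (head f) (tail f j)) * - ε (tail f)
      ≈⟨ sym (-‿distribʳ-* _ _) ⟩
    - ε f ∎

  ε-increasing : ∀ {k n} (f : Fin k → Fin n) → f Preserves _<_ ⟶ _<_ → ε f ≈ 1#
  ε-increasing {zero}  f f-mono = refl
  ε-increasing {suc k} f f-mono = trans
    (*-cong (product-one {f = λ j → sgn (head f) (f (suc j))} (λ j → sgn-< (f-mono (s≤s z≤n))))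
            (ε-increasing (tail f) (f-mono ∘ s≤s)))
    (*-identityˡ 1#)

  ε-id : ∀ {n} → ε (id {A = Fin n}) ≈ 1#
  ε-id {n} = ε-increasing {n} {n} id (λ i<j → i<j)

  record Alternating {n} k (Φ : (Fin (suc k) → Fin n) → Carrier) : Set ℓ where
    field
      cong : Φ Preserves _≗_ ⟶ _≈_
      swap : ∀ i f → Φ (f ∘ swapAdjacent i) ≈ - Φ f

  ε-alternating : ∀ {k n} → Alternating {n} k ε
  ε-alternating = record { cong = ε-cong ; swap = ε-swapAdjacent }

  alternating-∷ : ∀ {n k} {Φ : (Fin (suc (suc k)) → Fin n) → Carrier} →
    Alternating (suc k) Φ → ∀ a → Alternating k (λ f → Φ (a ∷ f))
  alternating-∷ {Φ = Φ} Φ-alt a = record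
    { cong = λ f≗g → cong (∷-congʳ a f≗g)
    ; swap = λ i f → trans (cong (∷-η ((a ∷ f) ∘ swapAdjacent (suc i)))) (swap (suc i) (a ∷ f))
    }
    where open Alternating Φ-alt

  negOnePow : ∀ {m} → Fin m → Carrier
  negOnePow zero    = 1#
  negOnePow (suc j) = - negOnePow j

  alternating-rotate : ∀ {n k} {Φ : (Fin (suc k) → Fin n) → Carrier} → Alternating k Φ →
    ∀ j f → Φ f ≈ negOnePow j * Φ (f j ∷ f ∘ punchIn j)
  alternating-rotate Φ-alt zero f =
    trans (Alternating.cong Φ-alt (≡.sym ∘ ∷-η f)) (sym (*-identityˡ _))
  alternating-rotate {k = suc k} {Φ} Φ-alt (suc j) f = begin
    Φ f                                    ≈⟨ cong (≡.sym ∘ ∷-η f) ⟩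
    Φ (head f ∷ tail f)                    ≈⟨ alternating-rotate (alternating-∷ Φ-alt (head f)) j (tail f) ⟩
    negOnePow j * Φ f′                     ≈⟨ *-congˡ (sym (-‿involutive _)) ⟩
    negOnePow j * - - Φ f′                 ≈⟨ *-congˡ (-‿cong (sym (swap zero f′))) ⟩
    negOnePow j * - Φ (f′ ∘ swapAdjacent zero)
      ≈⟨ *-congˡ (-‿cong (cong λ { zero → ≡.refl ; (suc zero) → ≡.refl ; (suc (suc _)) → ≡.refl })) ⟩
    negOnePow j * - Φ (f (suc j) ∷ f ∘ punchIn (suc j))
      ≈⟨ trans (sym (-‿distribʳ-* _ _)) (-‿distribˡ-* _ _) ⟩
    - negOnePow j * Φ (f (suc j) ∷ f ∘ punchIn (suc j)) ∎
    where
    open Alternating Φ-alt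
    f′ = head f ∷ f (suc j) ∷ tail f ∘ punchIn j

  record Sorting {k n} (g : Fin (suc k) → Fin n) : Set (c ⊔ ℓ) where
    field
      sign          : Carrier
      sorted        : Fin (suc k) → Fin n
      nondecreasing : Linked _≤_ (tabulate sorted)
      ⊆-image       : ∀ i → ∃ λ j → sorted i ≡ g j
      reorder       : ∀ Φ → Alternating k Φ → Φ g ≈ sign * Φ sorted

  -- Selection sort: a minimal value is rotated to the front by j adjacent swaps.
  sorting : ∀ {k n} (g : Fin (suc k) → Fin n) → Sorting g
  sorting {zero} g = record
    { sign = 1# ; sorted = g ; nondecreasing = [-] ; ⊆-image = λ i → i , ≡.refl
    ; reorder = λ Φ _ → sym (*-identityˡ _) }
  sorting {suc k} g with argmin g
  ... | j , min = record
    { sign          = negOnePow j * sign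
    ; sorted        = g j ∷ sorted
    ; nondecreasing = ≡.subst (g j ≤_) (≡.sym (proj₂ (⊆-image zero))) (min _) ∷ₗ nondecreasing
    ; ⊆-image       = λ { zero → j , ≡.refl ; (suc i) → punchIn j (proj₁ (⊆-image i)) , proj₂ (⊆-image i) }
    ; reorder       = λ Φ Φ-alt → begin
        Φ g                                    ≈⟨ alternating-rotate Φ-alt j g ⟩
        negOnePow j * Φ (g j ∷ g ∘ punchIn j)  ≈⟨ *-congˡ (reorder (λ f → Φ (g j ∷ f)) (alternating-∷ Φ-alt (g j))) ⟩
        negOnePow j * (sign * Φ (g j ∷ sorted)) ≈⟨ sym (*-assoc _ _ _) ⟩
        (negOnePow j * sign) * Φ (g j ∷ sorted) ∎
    }
    where open Sorting (sorting (g ∘ punchIn j))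

  -- The Leibniz formula summed over all maps Fin n → Fin n: ε vanishes on the non-injective ones.
  det : ∀ {n} → (Fin n → Fin n → Carrier) → Carrier
  det {n} A = ∑ᶠ n (λ f → ε f * product (λ i → A i (f i)))

  det-cong : ∀ {n} {A B : Fin n → Fin n → Carrier} → (∀ i j → A i j ≈ B i j) → det A ≈ det B
  det-cong {n} A≈B = ∑ᶠ-cong n (λ f → *-congˡ (product-cong (λ i → A≈B i (f i))))

  det-rows-alternating : ∀ {m} (A : Fin (suc m) → Fin (suc m) → Carrier) → Alternating m (λ g → det (A ∘ g))
  det-rows-alternating {m} A = record
    { cong = λ g≗g′ → det-cong (λ i j → reflexive (≡.cong (λ r → A r j) (g≗g′ i)))
    ; swap = swap-rows
    }
    where
    P : (Fin (suc m) → Fin (suc m)) → (Fin (suc m) → Fin (suc m)) → Carrier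
    P g f = product (λ j → A (g j) (f j))
    swap-rows : ∀ i g → det (A ∘ g ∘ swapAdjacent i) ≈ - det (A ∘ g)
    swap-rows i g = begin
      ∑ᶠ (suc m) (λ f → ε f * P gᵢ f)
        ≈⟨ ∑ᶠ-swapAdjacent m i (λ f → ε f * P gᵢ f) (λ f≗f′ → *-cong (ε-cong f≗f′)
             (product-cong (λ j → reflexive (≡.cong (A (gᵢ j)) (f≗f′ j))))) ⟨
      ∑ᶠ (suc m) (λ f → ε (f ∘ swapAdjacent i) * P gᵢ (f ∘ swapAdjacent i))
        ≈⟨ ∑ᶠ-cong (suc m) (λ f → *-cong (ε-swapAdjacent i f)
             (sym (product-permute (λ j → A (g j) (f j)) (swapAdjacentₚ i)))) ⟩
      ∑ᶠ (suc m) (λ f → - ε f * P g f)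
        ≈⟨ ∑ᶠ-cong (suc m) (λ f → sym (-‿distribˡ-* (ε f) (P g f))) ⟩
      ∑ᶠ (suc m) (λ f → - (ε f * P g f))
        ≈⟨ -‿∑ᶠ (suc m) (λ f → ε f * P g f) ⟩
      - det (A ∘ g) ∎
      where
      gᵢ = g ∘ swapAdjacent i

  det-headRow-zero : ∀ {m} (A : Fin (suc m) → Fin (suc m) → Carrier) → (∀ j → A zero j ≈ 0#) → det A ≈ 0#
  det-headRow-zero {m} A A₀≈0 = ∑ᶠ-zero (suc m)
    (λ f → trans (*-congˡ (product-zero (λ i → A i (f i)) zero (A₀≈0 (f zero)))) (zeroʳ (ε f)))

  det-scalar : ∀ {n} x → det {n} (λ i j → x * δ i j) ≈ pow R x n
  det-scalar {n} x = begin
    ∑ᶠ n (λ f → ε f * product (λ i → x * δ i (f i)))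
      ≈⟨ ∑ᶠ-cong n (λ f → trans (*-congˡ (trans (product-distrib-* (λ _ → x) (λ i → δ i (f i)))
                                                  (*-congʳ (product-const n x))))
                                (sym (*-assoc _ _ _))) ⟩
    ∑ᶠ n (λ f → (ε f * pow R x n) * product (λ i → δ i (f i)))
      ≈⟨ ∑ᶠ-δ n id (λ f → ε f * pow R x n) (λ f≗g → *-congʳ (ε-cong f≗g)) ⟩
    ε (id {A = Fin n}) * pow R x n
      ≈⟨ trans (*-congʳ (ε-id {n})) (*-identityˡ _) ⟩
    pow R x n ∎

  det-replaceHead : ∀ {m} (T : Fin (suc m) → Carrier) → det (T ∷ δ ∘ suc) ≈ T zero
  det-replaceHead {m} T = begin
    sum (λ a → ∑ᶠ m (λ f → ε (a ∷ f) * (T a * Δ f)))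
      ≈⟨ sum-cong-≋ (λ a → ∑ᶠ-cong m (λ f → sym (*-assoc (ε (a ∷ f)) (T a) (Δ f)))) ⟩
    sum (λ a → ∑ᶠ m (λ f → (ε (a ∷ f) * T a) * Δ f))
      ≈⟨ sum-cong-≋ (λ a → ∑ᶠ-δ m suc (λ f → ε (a ∷ f) * T a) (λ f≗g → *-congʳ (ε-cong (∷-congʳ a f≗g)))) ⟩
    ε {suc m} (zero ∷ suc) * T zero + sum (λ a → ε (suc a ∷ suc) * T (suc a))
      ≈⟨ +-cong (trans (*-congʳ (trans (ε-cong (∷-η (id {A = Fin (suc m)}))) (ε-id {suc m}))) (*-identityˡ (T zero)))
                (sum-zero (λ a → trans (*-congʳ (repeated a)) (zeroˡ (T (suc a))))) ⟩
    T zero + 0#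
      ≈⟨ +-identityʳ _ ⟩
    T zero ∎
    where
    Δ : (Fin m → Fin (suc m)) → Carrier
    Δ f = product (λ i → δ (suc i) (f i))
    repeated : ∀ a → ε (suc a ∷ suc) ≈ 0#
    repeated a = trans (*-congʳ (product-zero (λ j → sgn (suc a) (suc j)) a (sgn-refl a))) (zeroˡ _)

  -- Cancelling 2 is what makes an alternating form vanish on maps with two equal adjacent values.
  module _ (x+x≈0⇒x≈0 : ∀ x → x + x ≈ 0# → x ≈ 0#) where

    alternating-repeat : ∀ {n k} {Φ : (Fin (suc k) → Fin n) → Carrier} → Alternating k Φ →
      ∀ h i → h (inject₁ i) ≡ h (suc i) → Φ h ≈ 0#
    alternating-repeat {Φ = Φ} Φ-alt h i eq = x+x≈0⇒x≈0 _ (begin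
      Φ h + Φ h                     ≈⟨ +-congʳ (cong (λ j → ≡.sym (swapAdjacent-fixes h i eq j))) ⟩
      Φ (h ∘ swapAdjacent i) + Φ h  ≈⟨ +-congʳ (swap i h) ⟩
      - Φ h + Φ h                   ≈⟨ -‿inverseˡ _ ⟩
      0#                            ∎)
      where open Alternating Φ-alt

    alternating-nondecreasing : ∀ {m} {Φ : (Fin (suc m) → Fin (suc m)) → Carrier} → Alternating m Φ →
      ∀ h → Linked _≤_ (tabulate h) → Φ h ≈ ε h * Φ id
    alternating-nondecreasing {m} {Φ} Φ-alt h h-nondecreasing with nondecreasing-split h h-nondecreasing
    ... | inj₁ (i , eq) = begin
      Φ h         ≈⟨ alternating-repeat Φ-alt h i eq ⟩
      0#          ≈⟨ zeroˡ _ ⟨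
      0# * Φ id   ≈⟨ *-congʳ (alternating-repeat ε-alternating h i eq) ⟨
      ε h * Φ id  ∎
    ... | inj₂ h-increasing = begin
      Φ h         ≈⟨ Alternating.cong Φ-alt (increasing⇒≗id h h-increasing) ⟩
      Φ id        ≈⟨ *-identityˡ _ ⟨
      1# * Φ id   ≈⟨ *-congʳ (trans (ε-cong (increasing⇒≗id h h-increasing)) (ε-id {suc m})) ⟨
      ε h * Φ id  ∎

    alternating≈ε* : ∀ {m} {Φ : (Fin (suc m) → Fin (suc m)) → Carrier} → Alternating m Φ →
      ∀ g → Φ g ≈ ε g * Φ id
    alternating≈ε* {Φ = Φ} Φ-alt g = begin
      Φ g                   ≈⟨ reorder Φ Φ-alt ⟩
      sign * Φ sorted       ≈⟨ *-congˡ (alternating-nondecreasing Φ-alt sorted nondecreasing) ⟩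
      sign * (ε sorted * Φ id) ≈⟨ *-assoc _ _ _ ⟨
      (sign * ε sorted) * Φ id ≈⟨ *-congʳ (reorder ε ε-alternating) ⟨
      ε g * Φ id            ∎
      where open Sorting (sorting g)

    det-* : ∀ {m} (B A : Fin (suc m) → Fin (suc m) → Carrier) →
      det (λ i j → sum (λ k → B i k * A k j)) ≈ det B * det A
    det-* {m} B A = begin
      ∑ᶠ n (λ f → ε f * product (λ i → sum (λ k → B i k * A k (f i))))
        ≈⟨ ∑ᶠ-cong n (λ f → *-congˡ {ε f} (product-sum n (λ i k → B i k * A k (f i)))) ⟩
      ∑ᶠ n (λ f → ε f * ∑ᶠ n (λ g → product (λ i → B i (g i) * A (g i) (f i))))
        ≈⟨ ∑ᶠ-cong n (λ f → *-distribˡ-∑ᶠ n (ε f) (λ g → product (λ i → B i (g i) * A (g i) (f i)))) ⟩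
      ∑ᶠ n (λ f → ∑ᶠ n (λ g → ε f * product (λ i → B i (g i) * A (g i) (f i))))
        ≈⟨ ∑ᶠ-comm n n (λ f g → ε f * product (λ i → B i (g i) * A (g i) (f i))) ⟩
      ∑ᶠ n (λ g → ∑ᶠ n (λ f → ε f * product (λ i → B i (g i) * A (g i) (f i))))
        ≈⟨ ∑ᶠ-cong n (λ g → ∑ᶠ-cong n (λ f → trans (*-congˡ (product-distrib-* (λ i → B i (g i)) (λ i → A (g i) (f i))))
                                                  (x∙yz≈y∙xz (ε f) (B↓ g) _))) ⟩
      ∑ᶠ n (λ g → ∑ᶠ n (λ f → B↓ g * (ε f * product (λ i → A (g i) (f i)))))
        ≈⟨ ∑ᶠ-cong n (λ g → *-distribˡ-∑ᶠ n (B↓ g) (λ f → ε f * product (λ i → A (g i) (f i)))) ⟨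
      ∑ᶠ n (λ g → B↓ g * det (A ∘ g))
        ≈⟨ ∑ᶠ-cong n (λ g → trans (*-congˡ (alternating≈ε* (det-rows-alternating A) g))
                                 (trans (x∙yz≈y∙xz (B↓ g) (ε g) (det A)) (sym (*-assoc _ _ _)))) ⟩
      ∑ᶠ n (λ g → (ε g * B↓ g) * det A)
        ≈⟨ *-distribʳ-∑ᶠ n (det A) (λ g → ε g * B↓ g) ⟨
      det B * det A ∎
      where
      n = suc m
      B↓ : (Fin n → Fin n) → Carrier
      B↓ g = product (λ i → B i (g i))

    module _ (noZeroDivisors : ∀ x y → x * y ≈ 0# → x ≈ 0# ⊎ y ≈ 0#) where

      leftKernel-head : ∀ {m} (H A : Fin (suc m) → Fin (suc m) → Carrier) c → ¬ pow R c (suc m) ≈ 0# →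
        (∀ j k → sum (λ i → H j i * A i k) ≈ c * δ j k) →
        ∀ T → (∀ j → sum (λ k → T k * A k j) ≈ 0#) → T zero ≈ 0#
      leftKernel-head {m} H A c cⁿ≉0 HA≈cI T TA≈0 with noZeroDivisors (T zero) (det A) T₀·detA≈0
        where
        T₀·detA≈0 : T zero * det A ≈ 0#
        T₀·detA≈0 = begin
          T zero * det A             ≈⟨ *-congʳ (det-replaceHead T) ⟨
          det (T ∷ δ ∘ suc) * det A  ≈⟨ det-* (T ∷ δ ∘ suc) A ⟨
          det ETA                    ≈⟨ det-headRow-zero ETA TA≈0 ⟩
          0#                         ∎
          where
          ETA : Fin (suc m) → Fin (suc m) → Carrier
          ETA i j = sum (λ k → (T ∷ δ ∘ suc) i k * A k j)
      ... | inj₁ T₀≈0   = T₀≈0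
      ... | inj₂ detA≈0 = contradiction (begin
          pow R c (suc m)                          ≈⟨ det-scalar {suc m} c ⟨
          det {suc m} (λ i j → c * δ i j)          ≈⟨ det-cong {suc m} {B = λ i j → c * δ i j} HA≈cI ⟨
          det (λ i j → sum (λ k → H i k * A k j))  ≈⟨ det-* H A ⟩
          det H * det A                            ≈⟨ *-congˡ detA≈0 ⟩
          det H * 0#                               ≈⟨ zeroʳ _ ⟩
          0#                                       ∎) cⁿ≉0

      leftKernel-trivial : ∀ {m} (H A : Fin (suc m) → Fin (suc m) → Carrier) c → ¬ pow R c (suc m) ≈ 0# →
        (∀ j k → sum (λ i → H j i * A i k) ≈ c * δ j k) →
        ∀ T → (∀ j → sum (λ k → T k * A k j) ≈ 0#) → ∀ i → T i ≈ 0#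
      leftKernel-trivial H A c cⁿ≉0 HA≈cI T TA≈0 i =
        leftKernel-head (λ j k → H j (π k)) (λ k l → A (π k) l) c cⁿ≉0
          (λ j l → trans (sym (sum-permute (λ k → H j k * A k l) (transpose zero i))) (HA≈cI j l))
          (T ∘ π)
          (λ j → trans (sym (sum-permute (λ k → T k * A k j) (transpose zero i))) (TA≈0 j))
        where
        π = transpose zero i ⟨$⟩ʳ_

      scaledInverse-comm : ∀ {m} (H A : Fin (suc m) → Fin (suc m) → Carrier) c → ¬ pow R c (suc m) ≈ 0# →
        (∀ j k → sum (λ i → H j i * A i k) ≈ c * δ j k) →
        (∀ j k → sum (λ i → A j i * H i k) ≈ c * δ j k)
      scaledInverse-comm H A c cⁿ≉0 HA≈cI l k =
        x∙y⁻¹≈ε⇒x≈y _ _ (leftKernel-trivial H A c cⁿ≉0 HA≈cI T TA≈0 k)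
        where
        T = λ k → sum (λ i → A l i * H i k) - c * δ l k
        AHA≈cA : ∀ j → sum (λ k → sum (λ i → A l i * H i k) * A k j) ≈ c * A l j
        AHA≈cA j = begin
          sum (λ k → sum (λ i → A l i * H i k) * A k j)
            ≈⟨ sum-cong-≋ (λ k → *-distribʳ-sum (A k j) (λ i → A l i * H i k)) ⟩
          sum (λ k → sum (λ i → (A l i * H i k) * A k j))
            ≈⟨ ∑-comm (λ k i → (A l i * H i k) * A k j) ⟩
          sum (λ i → sum (λ k → (A l i * H i k) * A k j))
            ≈⟨ sum-cong-≋ (λ i → trans (sum-cong-≋ (λ k → *-assoc (A l i) (H i k) (A k j)))
                                       (sym (*-distribˡ-sum (A l i) (λ k → H i k * A k j)))) ⟩
          sum (λ i → A l i * sum (λ k → H i k * A k j))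
            ≈⟨ sum-cong-≋ (λ i → trans (*-congˡ (HA≈cI i j)) (rearrange i)) ⟩
          sum (λ i → δ j i * (c * A l i))
            ≈⟨ ∑-δ j (λ i → c * A l i) ⟩
          c * A l j ∎
          where
          rearrange : ∀ i → A l i * (c * δ i j) ≈ δ j i * (c * A l i)
          rearrange i = trans (x∙yz≈y∙xz (A l i) c (δ i j))
            (trans (*-congˡ (trans (*-comm (A l i) (δ i j)) (*-congʳ (reflexive (δ-sym i j)))))
                   (x∙yz≈y∙xz c (δ j i) (A l i)))
        TA≈0 : ∀ j → sum (λ k → T k * A k j) ≈ 0#
        TA≈0 j = begin
          sum (λ k → T k * A k j)
            ≈⟨ sum-cong-≋ (λ k → distribʳ (A k j) (sum (λ i → A l i * H i k)) (- (c * δ l k))) ⟩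
          sum (λ k → sum (λ i → A l i * H i k) * A k j + (- (c * δ l k)) * A k j)
            ≈⟨ ∑-distrib-+ (λ k → sum (λ i → A l i * H i k) * A k j) (λ k → (- (c * δ l k)) * A k j) ⟩
          sum (λ k → sum (λ i → A l i * H i k) * A k j) + sum (λ k → (- (c * δ l k)) * A k j)
            ≈⟨ +-cong (AHA≈cA j) (trans (sum-cong-≋ (λ k → rearrange k)) (∑-δ l (λ k → - (c * A k j)))) ⟩
          c * A l j - c * A l j
            ≈⟨ -‿inverseʳ _ ⟩
          0# ∎
          where
          rearrange : ∀ k → (- (c * δ l k)) * A k j ≈ δ l k * (- (c * A k j))
          rearrange k = trans (sym (-‿distribˡ-* (c * δ l k) (A k j)))
            (trans (-‿cong (trans (*-congʳ (*-comm c (δ l k))) (*-assoc (δ l k) c (A k j))))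
                   (-‿distribʳ-* (δ l k) (c * A k j)))

module ButsonHadamard {c ℓ} {K : CommutativeRing c ℓ} (D : CharZeroDomain K) where

  open CommutativeRing K hiding (zero)
  open import Data.Bool using (if_then_else_)
  open import Relation.Nullary.Decidable using (⌊_⌋)
  open CharZeroDomain D
  open Determinant K
  open import Algebra.Properties.Semiring.Sum semiring using (sum; sum-cong-≋)

  x+x≈0⇒x≈0 : ∀ x → x + x ≈ 0# → x ≈ 0#
  x+x≈0⇒x≈0 x x+x≈0 with noZeroDiv (natK K 2) x 2x≈0
    where
    2x≈0 : (1# + (1# + 0#)) * x ≈ 0#
    2x≈0 = trans (distribʳ x _ _) (trans (+-cong (*-identityˡ x)
             (trans (distribʳ x _ _) (trans (+-cong (*-identityˡ x) (zeroˡ x)) (+-identityʳ x)))) x+x≈0)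
  ... | inj₁ 2≈0 = contradiction 2≈0 (charZero 1)
  ... | inj₂ x≈0 = x≈0

  pow-nonzero : ∀ x → ¬ x ≈ 0# → ∀ k → ¬ pow K x k ≈ 0#
  pow-nonzero x x≉0 zero    = nontrivial
  pow-nonzero x x≉0 (suc k) xᵏ⁺¹≈0 with noZeroDiv x (pow K x k) xᵏ⁺¹≈0
  ... | inj₁ x≈0  = x≉0 x≈0
  ... | inj₂ xᵏ≈0 = pow-nonzero x x≉0 k xᵏ≈0

  sumF≡sum : ∀ n (f : Fin n → Carrier) → sumF K n f ≡ sum f
  sumF≡sum zero    f = ≡.refl
  sumF≡sum (suc n) f = ≡.cong (f zero +_) (sumF≡sum n (f ∘ suc))

  -- Hᵀ H̄ = n I, the complex conjugate of H* H = n I.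
  hadamard-transpose : ∀ {m q ω} (L : LogMatrix (suc m) (suc m) q) →
    IsButsonHadamard K (suc m) q ω L → IsButsonHadamard K (suc m) q ω (λ j k → L k j)
  hadamard-transpose {m} {q} {ω} L L-hadamard j k = begin
    sumF K (suc m) (λ i → H i j * A k i) ≡⟨ sumF≡sum (suc m) (λ i → H i j * A k i) ⟩
    sum (λ i → H i j * A k i)            ≈⟨ sum-cong-≋ (λ i → *-comm (H i j) (A k i)) ⟩
    sum (λ i → A k i * H i j)            ≈⟨ scaledInverse-comm x+x≈0⇒x≈0 noZeroDiv H A n
                                             (pow-nonzero n (charZero m) (suc m)) HA≈nI k j ⟩
    n * δ k j                            ≡⟨ ≡.cong (n *_) (δ-sym k j) ⟩
    n * δ j k                            ≈⟨ if-≟≈*δ j k n ⟨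
    (if ⌊ j Fin.≟ k ⌋ then n else 0#)    ∎
    where
    open import Relation.Binary.Reasoning.Setoid setoid
    n = natK K (suc m)
    H A : Fin (suc m) → Fin (suc m) → Carrier
    H j i = entry K q ω (L j i)
    A i k = conjEntry K q ω (L k i)
    HA≈nI : ∀ j k → sum (λ i → H j i * A i k) ≈ n * δ j k
    HA≈nI j k = trans (reflexive (≡.sym (sumF≡sum (suc m) (λ i → H j i * A i k))))
                      (trans (L-hadamard j k) (if-≟≈*δ j k n))

  hadamard-rowSum : ∀ {m q ω} (L : LogMatrix (suc m) (suc m) (suc q)) → pow K ω (suc q) ≈ 1# →
    IsButsonHadamard K (suc m) (suc q) ω L → (∀ k → L zero k ≡ zero) →
    ∀ i → E K (suc m) (suc q) ω (L (suc i)) ≈ 0#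
  hadamard-rowSum {m} {q} {ω} L ωᵠ≈1 L-hadamard headRow-zero i = begin
    sumF K (suc m) row                         ≡⟨ sumF≡sum (suc m) row ⟩
    sum row                                    ≈⟨ sum-cong-≋ {y = row} row*row₀‾≈row ⟨
    sum (λ k → row k * row₀‾ k)                ≡⟨ sumF≡sum (suc m) (λ k → row k * row₀‾ k) ⟨
    sumF K (suc m) (λ k → row k * row₀‾ k)     ≈⟨ L-hadamard (suc i) zero ⟩
    0#                                         ∎
    where
    open import Relation.Binary.Reasoning.Setoid setoid
    row row₀‾ : Fin (suc m) → Carrier
    row k   = entry K (suc q) ω (L (suc i) k)
    row₀‾ k = conjEntry K (suc q) ω (L zero k)
    row*row₀‾≈row : ∀ k → row k * row₀‾ k ≈ row k
    row*row₀‾≈row k = trans (*-congˡ (trans (reflexive (≡.cong (conjEntry K (suc q) ω) (headRow-zero k))) ωᵠ≈1))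
                            (*-identityʳ _)

module LexicographicOrder where

  open import Data.List using (List; []; _∷_; _++_; concat; length)
  open import Data.List.Properties using (length-tabulate; tabulate-cong; map-tabulate)
  open import Data.Unit using (tt)
  open import Data.Fin.Permutation using (remove; lift₀-remove; _∘ₚ_)
  open ≡ using (refl; sym; trans; cong; subst; subst₂)
  open Sequences using (transpose-matchˡ; transpose-invariant)

  ≼-++-prefix : ∀ {q} (xs xs′ ys ys′ : List (Fin q)) → length xs ≡ length xs′ →
    (xs ++ ys) ≼ (xs′ ++ ys′) → xs ≼ xs′
  ≼-++-prefix []       []         ys ys′ _  _                    = tt
  ≼-++-prefix (x ∷ xs) (x′ ∷ xs′) ys ys′ _  (inj₁ x<x′)         = inj₁ x<x′
  ≼-++-prefix (x ∷ xs) (x′ ∷ xs′) ys ys′ eq (inj₂ (x≡x′ , rest)) =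
    inj₂ (x≡x′ , ≼-++-prefix xs xs′ ys ys′ (ℕ.suc-injective eq) rest)

  ≼-++-cancelˡ : ∀ {q} (xs ys ys′ : List (Fin q)) → (xs ++ ys) ≼ (xs ++ ys′) → ys ≼ ys′
  ≼-++-cancelˡ []       ys ys′ ys≼ys′          = ys≼ys′
  ≼-++-cancelˡ (x ∷ xs) ys ys′ (inj₁ x<x)      = ⊥-elim (ℕ.<-irrefl refl x<x)
  ≼-++-cancelˡ (x ∷ xs) ys ys′ (inj₂ (_ , rest)) = ≼-++-cancelˡ xs ys ys′ rest

  ≼-head-zero : ∀ {q k} (u v : Fin (suc k) → Fin (suc q)) →
    tabulate u ≼ tabulate v → v zero ≡ zero → u zero ≡ zero
  ≼-head-zero u v (inj₁ u₀<v₀)      v₀≡0 = ⊥-elim (ℕ.n≮0 (subst (λ x → toℕ (u zero) ℕ.< toℕ x) v₀≡0 u₀<v₀))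
  ≼-head-zero u v (inj₂ (u₀≡v₀ , _)) v₀≡0 = trans u₀≡v₀ v₀≡0

  ≼-zeros : ∀ {q k} (u v : Fin k → Fin (suc q)) →
    tabulate u ≼ tabulate v → (∀ i → v i ≡ zero) → ∀ i → u i ≡ zero
  ≼-zeros u v u≼v v≡0 zero = ≼-head-zero u v u≼v (v≡0 zero)
  ≼-zeros u v (inj₁ u₀<v₀)       v≡0 (suc i) =
    ⊥-elim (ℕ.n≮0 (subst (λ x → toℕ (u zero) ℕ.< toℕ x) (v≡0 zero) u₀<v₀))
  ≼-zeros u v (inj₂ (_ , u′≼v′)) v≡0 (suc i) = ≼-zeros (u ∘ suc) (v ∘ suc) u′≼v′ (v≡0 ∘ suc) i

  ≼-second : ∀ {q k} (u v : Fin (suc (suc k)) → Fin q) →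
    tabulate u ≼ tabulate v → u zero ≡ v zero → u (suc zero) ≤ v (suc zero)
  ≼-second u v (inj₁ u₀<v₀)                       u₀≡v₀ = ⊥-elim (ℕ.<-irrefl (cong toℕ u₀≡v₀) u₀<v₀)
  ≼-second u v (inj₂ (_ , inj₁ u₁<v₁))            _     = ℕ.<⇒≤ u₁<v₁
  ≼-second u v (inj₂ (_ , inj₂ (u₁≡v₁ , _)))      _     = ℕ.≤-reflexive (cong toℕ u₁≡v₁)

  rows : ∀ {q r k} → (Fin r → Fin k → Fin q) → List (Fin q)
  rows B = concat (tabulate (tabulate ∘ B))

  vecM≡rows : ∀ {q r k} (L : LogMatrix r k q) → vecM L ≡ rows L
  vecM≡rows L = cong concat (trans (map-tabulate id _) (tabulate-cong (λ j → map-tabulate id (L j))))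

  vecV≡tabulate : ∀ {q k} (x : Fin k → Fin q) → vecV x ≡ tabulate x
  vecV≡tabulate x = map-tabulate id x

  rows-≼⇒row-≼ : ∀ {q r k} (B B′ : Fin r → Fin k → Fin q) (j : Fin r) →
    (∀ i → i < j → B i ≗ B′ i) → rows B ≼ rows B′ → tabulate (B j) ≼ tabulate (B′ j)
  rows-≼⇒row-≼ B B′ zero _ B≼B′ =
    ≼-++-prefix _ _ _ _ (trans (length-tabulate (B zero)) (sym (length-tabulate (B′ zero)))) B≼B′
  rows-≼⇒row-≼ B B′ (suc j) B≗B′ B≼B′ =
    rows-≼⇒row-≼ (B ∘ suc) (B′ ∘ suc) j (λ i i<j → B≗B′ (suc i) (s≤s i<j))
      (≼-++-cancelˡ (tabulate (B zero)) _ _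
        (subst (λ xs → (tabulate (B zero) ++ rows (B ∘ suc)) ≼ (xs ++ rows (B′ ∘ suc)))
               (sym (tabulate-cong (B≗B′ zero (s≤s z≤n)))) B≼B′))

  monotone-≼-permute : ∀ {q k} (x : Fin k → Fin q) → x Preserves _≤_ ⟶ _≤_ →
    ∀ (π : Permutation′ k) → tabulate x ≼ tabulate (x ∘ (π ⟨$⟩ʳ_))
  monotone-≼-permute {k = zero}  x x-mono π = tt
  monotone-≼-permute {k = suc k} x x-mono π with x zero Fin.<? x (π ⟨$⟩ʳ zero)
  ... | yes x₀<xπ₀ = inj₁ x₀<xπ₀
  ... | no  x₀≮xπ₀ = inj₂ (x₀≡xp , subst (tabulate (x ∘ suc) ≼_) (tabulate-cong tail-agrees)
                                        (monotone-≼-permute (x ∘ suc) (x-mono ∘ s≤s) (remove zero ρ)))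
    where
    p = π ⟨$⟩ʳ zero
    x₀≡xp : x zero ≡ x p
    x₀≡xp = toℕ-injective (ℕ.≤-antisym (x-mono z≤n) (ℕ.≮⇒≥ x₀≮xπ₀))
    ρ : Permutation′ (suc k)
    ρ = π ∘ₚ transpose p zero
    tail-agrees : ∀ i → x (suc (remove zero ρ ⟨$⟩ʳ i)) ≡ x (π ⟨$⟩ʳ suc i)
    tail-agrees i = trans (cong x (lift₀-remove ρ (transpose-matchˡ p zero) (suc i)))
                          (transpose-invariant x p zero (sym x₀≡xp) (π ⟨$⟩ʳ suc i))

  ≼-permutations⇒sorted : ∀ {q k} (x : Fin k → Fin q) →
    (∀ (π : Permutation′ k) → tabulate x ≼ tabulate (x ∘ (π ⟨$⟩ʳ_))) → IsSorted x
  ≼-permutations⇒sorted x x≼xπ = (Perm.id , refl) , λ y (π , y≡xπ) →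
    subst₂ _≼_ (sym (vecV≡tabulate x)) (sym (trans y≡xπ (vecV≡tabulate _))) (x≼xπ π)

  monotone⇒sorted : ∀ {q k} (x : Fin k → Fin q) → x Preserves _≤_ ⟶ _≤_ → IsSorted x
  monotone⇒sorted x x-mono = ≼-permutations⇒sorted x (monotone-≼-permute x x-mono)

module CanonicalForm where

  open import Data.Nat using (_+_; _%_)
  open import Data.Nat.DivMod using (_mod_; [m+n]%n≡m%n; m<n⇒m%n≡m; n%n≡0; %-distribˡ-+)
  open import Data.Fin.Properties using (toℕ-fromℕ<)
  open import Data.Fin.Induction using (<-wellFounded)
  open import Induction.WellFounded using (module All)
  open import Data.List.Properties using (tabulate-cong)
  open ≡ using (refl; sym; trans; cong; cong₂; subst; subst₂; module ≡-Reasoning)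
  open Sequences using (transpose-matchˡ; transpose-other)
  open LexicographicOrder

  negate : ∀ {q} → Fin (suc q) → Fin (suc q)
  negate {q} x = (suc q ∸ toℕ x) mod suc q

  negate-zero : ∀ {q} → negate {q} zero ≡ zero
  negate-zero {q} = toℕ-injective (trans (toℕ-fromℕ< _) (n%n≡0 (suc q)))

  module _ {q r n} (σ : Permutation′ r) (τ : Permutation′ n) (a : Fin r → Fin (suc q)) (b : Fin n → Fin (suc q))
           (L : LogMatrix r n (suc q)) (j : Fin r) (k : Fin n) where

    private
      Q = suc q
      x = toℕ (L (σ ⟨$⟩ʳ j) (τ ⟨$⟩ʳ k))
      x<Q = toℕ<n (L (σ ⟨$⟩ʳ j) (τ ⟨$⟩ʳ k))
      open ≡-Reasoning

      toℕ-monomialAction : toℕ (monomialAction σ τ a b L j k) ≡ (toℕ (a j) + x + (Q ∸ toℕ (b k))) % Q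
      toℕ-monomialAction = toℕ-fromℕ< _

    monomialAction-unscaled : a j ≡ zero → b k ≡ zero → monomialAction σ τ a b L j k ≡ L (σ ⟨$⟩ʳ j) (τ ⟨$⟩ʳ k)
    monomialAction-unscaled aⱼ≡0 bₖ≡0 = toℕ-injective (begin
      toℕ (monomialAction σ τ a b L j k)      ≡⟨ toℕ-monomialAction ⟩
      (toℕ (a j) + x + (Q ∸ toℕ (b k))) % Q   ≡⟨ cong₂ (λ u v → (toℕ u + x + (Q ∸ toℕ v)) % Q) aⱼ≡0 bₖ≡0 ⟩
      (x + Q) % Q                             ≡⟨ [m+n]%n≡m%n x Q ⟩
      x % Q                                   ≡⟨ m<n⇒m%n≡m x<Q ⟩
      x                                       ∎)

    monomialAction-cancelColumn : a j ≡ zero → b k ≡ L (σ ⟨$⟩ʳ j) (τ ⟨$⟩ʳ k) → monomialAction σ τ a b L j k ≡ zero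
    monomialAction-cancelColumn aⱼ≡0 bₖ≡Lⱼₖ = toℕ-injective (begin
      toℕ (monomialAction σ τ a b L j k)      ≡⟨ toℕ-monomialAction ⟩
      (toℕ (a j) + x + (Q ∸ toℕ (b k))) % Q   ≡⟨ cong₂ (λ u v → (toℕ u + x + (Q ∸ toℕ v)) % Q) aⱼ≡0 bₖ≡Lⱼₖ ⟩
      (x + (Q ∸ x)) % Q                       ≡⟨ cong (_% Q) (ℕ.m+[n∸m]≡n (ℕ.<⇒≤ x<Q)) ⟩
      Q % Q                                   ≡⟨ n%n≡0 Q ⟩
      0                                       ∎)

    monomialAction-cancelRow : a j ≡ negate (L (σ ⟨$⟩ʳ j) (τ ⟨$⟩ʳ k)) → b k ≡ zero →
      monomialAction σ τ a b L j k ≡ zero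
    monomialAction-cancelRow aⱼ≡-Lⱼₖ bₖ≡0 = toℕ-injective (begin
      toℕ (monomialAction σ τ a b L j k)      ≡⟨ toℕ-monomialAction ⟩
      (toℕ (a j) + x + (Q ∸ toℕ (b k))) % Q   ≡⟨ cong (λ v → (toℕ (a j) + x + (Q ∸ toℕ v)) % Q) bₖ≡0 ⟩
      (toℕ (a j) + x + Q) % Q                 ≡⟨ [m+n]%n≡m%n (toℕ (a j) + x) Q ⟩
      (toℕ (a j) + x) % Q                     ≡⟨ cong (λ y → (y + x) % Q) toℕ-aⱼ ⟩
      ((Q ∸ x) % Q + x) % Q                   ≡⟨ cong (λ y → ((Q ∸ x) % Q + y) % Q) (m<n⇒m%n≡m x<Q) ⟨
      ((Q ∸ x) % Q + x % Q) % Q               ≡⟨ %-distribˡ-+ (Q ∸ x) x Q ⟨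
      (Q ∸ x + x) % Q                         ≡⟨ cong (_% Q) (ℕ.m∸n+n≡m (ℕ.<⇒≤ x<Q)) ⟩
      Q % Q                                   ≡⟨ n%n≡0 Q ⟩
      0                                       ∎)
      where
      toℕ-aⱼ : toℕ (a j) ≡ (Q ∸ x) % Q
      toℕ-aⱼ = trans (cong toℕ aⱼ≡-Lⱼₖ) (toℕ-fromℕ< _)

  module _ {q r n} {L : LogMatrix r n (suc q)} (L-canonical : IsCanonical L) where

    canonical-≼ : ∀ σ τ a b → rows L ≼ rows (monomialAction σ τ a b L)
    canonical-≼ σ τ a b =
      subst₂ _≼_ (vecM≡rows L) (vecM≡rows (monomialAction σ τ a b L)) (proj₂ L-canonical _ (σ , τ , a , b , refl))

    canonical-row-≼ : ∀ σ τ a b j → (∀ i → i < j → L i ≗ monomialAction σ τ a b L i) →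
      tabulate (L j) ≼ tabulate (monomialAction σ τ a b L j)
    canonical-row-≼ σ τ a b j agree = rows-≼⇒row-≼ L _ j agree (canonical-≼ σ τ a b)

  canonical-headRow : ∀ {q r n} {L : LogMatrix (suc r) n (suc q)} → IsCanonical L → ∀ k → L zero k ≡ zero
  canonical-headRow {L = L} L-canonical = ≼-zeros (L zero) (M zero)
    (canonical-row-≼ L-canonical Perm.id Perm.id (λ _ → zero) (L zero) zero (λ _ ()))
    (λ k → monomialAction-cancelColumn Perm.id Perm.id (λ _ → zero) (L zero) L zero k refl refl)
    where
    M = monomialAction Perm.id Perm.id (λ _ → zero) (L zero) L

  -- Strong induction on j: dividing every row by its first entry leaves the rows above j unchanged.
  canonical-headColumn : ∀ {q r n} {L : LogMatrix r (suc n) (suc q)} → IsCanonical L → ∀ j → L j zero ≡ zero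
  canonical-headColumn {q} {r} {L = L} L-canonical = All.wfRec <-wellFounded _ (λ j → L j zero ≡ zero) step
    where
    a : Fin r → Fin (suc q)
    a i = negate (L i zero)
    step : ∀ j → (∀ {i} → i < j → L i zero ≡ zero) → L j zero ≡ zero
    step j below = ≼-head-zero (L j) (monomialAction Perm.id Perm.id a (λ _ → zero) L j)
      (canonical-row-≼ L-canonical Perm.id Perm.id a (λ _ → zero) j (λ i i<j k →
        sym (monomialAction-unscaled Perm.id Perm.id a (λ _ → zero) L i k
               (trans (cong negate (below i<j)) negate-zero) refl)))
      (monomialAction-cancelRow Perm.id Perm.id a (λ _ → zero) L j zero refl refl)

  canonical-secondRow-sorted : ∀ {q r n} {L : LogMatrix (suc (suc r)) n (suc q)} → IsCanonical L →
    IsSorted (L (suc zero))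
  canonical-secondRow-sorted {L = L} L-canonical = ≼-permutations⇒sorted (L (suc zero)) λ τ →
    subst (tabulate (L (suc zero)) ≼_) (tabulate-cong (permuted τ (suc zero)))
      (canonical-row-≼ L-canonical Perm.id τ (λ _ → zero) (λ _ → zero) (suc zero) λ where
        zero _ k → trans (canonical-headRow L-canonical k)
                         (sym (trans (permuted τ zero k) (canonical-headRow L-canonical (τ ⟨$⟩ʳ k))))
        (suc _) (s≤s ()))
    where
    permuted : ∀ τ i k → monomialAction Perm.id τ (λ _ → zero) (λ _ → zero) L i k ≡ L i (τ ⟨$⟩ʳ k)
    permuted τ i k = monomialAction-unscaled Perm.id τ (λ _ → zero) (λ _ → zero) L i k refl refl

  canonical-rows-≼ : ∀ {q r n} {L : LogMatrix r n (suc q)} → IsCanonical L →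
    ∀ {j k} → j < k → tabulate (L j) ≼ tabulate (L k)
  canonical-rows-≼ {L = L} L-canonical {j} {k} j<k =
    subst (tabulate (L j) ≼_) (tabulate-cong λ l → trans (permuted j l) (cong (λ i → L i l) (transpose-matchˡ j k)))
      (canonical-row-≼ L-canonical σ Perm.id (λ _ → zero) (λ _ → zero) j λ i i<j l →
        sym (trans (permuted i l) (cong (λ i′ → L i′ l)
          (transpose-other j k i (λ i≡j → ℕ.<-irrefl (cong toℕ i≡j) i<j)
                                 (λ i≡k → ℕ.<-irrefl (cong toℕ i≡k) (ℕ.<-trans i<j j<k))))))
    where
    σ = transpose j k
    permuted : ∀ i l → monomialAction σ Perm.id (λ _ → zero) (λ _ → zero) L i l ≡ L (σ ⟨$⟩ʳ i) l
    permuted i l = monomialAction-unscaled σ Perm.id (λ _ → zero) (λ _ → zero) L i l refl refl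

  canonical-secondColumn-monotone : ∀ {q r n} {L : LogMatrix r (suc (suc n)) (suc q)} → IsCanonical L →
    (λ j → L j (suc zero)) Preserves _≤_ ⟶ _≤_
  canonical-secondColumn-monotone {L = L} L-canonical {j} {k} j≤k with ℕ.m≤n⇒m<n∨m≡n j≤k
  ... | inj₁ j<k = ≼-second (L j) (L k) (canonical-rows-≼ L-canonical j<k)
                     (trans (canonical-headColumn L-canonical j) (sym (canonical-headColumn L-canonical k)))
  ... | inj₂ j≡k = ℕ.≤-reflexive (cong (λ i → toℕ (L i (suc zero))) (toℕ-injective j≡k))

mainTheorem13 : ∀ {c ℓ} (K : CommutativeRing c ℓ) (q : ℕ) .{{_ : NonZero q}}
    (ω : CommutativeRing.Carrier K) → CharZeroDomain K → PrimitiveRoot K q ω →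
    (m : ℕ) (L : LogMatrix (suc (suc m)) (suc (suc m)) q) →
    IsButsonHadamard K (suc (suc m)) q ω L → IsCanonical L →
    InO K (suc m) q ω (λ k → L (Fin.suc Fin.zero) k) × InO K (suc m) q ω (λ j → L j (Fin.suc Fin.zero))
mainTheorem13 K (suc q) ω D ω-primitive m L L-hadamard L-canonical =
  ( ( ≡.cong toℕ (canonical-headColumn L-canonical (suc zero))
    , canonical-secondRow-sorted L-canonical
    , hadamard-rowSum L ωᵠ≈1 L-hadamard (canonical-headRow L-canonical) zero )
  , ( ≡.cong toℕ (canonical-headRow L-canonical (suc zero))
    , monotone⇒sorted _ (canonical-secondColumn-monotone L-canonical)
    , hadamard-rowSum (λ j k → L k j) ωᵠ≈1 (hadamard-transpose L L-hadamard) (canonical-headColumn L-canonical) zero ) )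
  where
  open ButsonHadamard D
  open LexicographicOrder using (monotone⇒sorted)
  open CanonicalForm
  ωᵠ≈1 = PrimitiveRoot.root ω-primitive
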